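{- Let $n,m,r,s$ be non-negative integers and let $p$ be a prime with $p\nmid m$. Then $$\sum_{k=1}^{p-1}\frac{\mathcal{F}_{n+k}(x;r,s)}{(-m)^k}\equiv (-m)^n\left(\mathcal{F}_{p-1}(x;r+m,s)-s!\right)\pmod{p\mathbb{Z}_p[x]}.$$
   Context: ${n\brace k}_r$ denotes the $r$-Stirling numbers of the second kind: the number of partitions of $\{1,\dots,n\}$ into $k$ nonempty blocks such that $1,\dots,r$ lie in distinct blocks (for $r=0$ these are the ordinary Stirling numbers). The $(r,s)$-Fubini polynomials are $\mathcal{F}_n(x;r,s)=\sum_{k=0}^n {n+r\brace k+r}_r (k+s)!\,x^k$. Here $\mathbb{Z}_p$ is the ring of $p$-adic integers (so $1/(-m)^k\in\mathbb{Z}_p$ as $p\nmid m$), and $A\equiv B\pmod{p\mathbb{Z}_p[x]}$ means corresponding coefficients of $A,B\in\mathbb{Z}_p[x]$ are congruent modulo $p$. -}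

module Defs where

open import Data.Nat as ℕ using (ℕ; zero; suc; _≤ᵇ_; _≡ᵇ_)
open import Data.Nat using (_!)
open import Data.Nat.Divisibility using (_∣_)
open import Data.Bool using (if_then_else_)
open import Data.Integer as ℤ using (ℤ; +_)
open import Data.Rational as ℚ using (ℚ; 0ℚ; 1ℚ; _+_; _*_; _-_; -_; ↥_; ↧ₙ_; 1/_; ≢-nonZero)
open import Data.Rational.Properties using (_≟_)
open import Relation.Nullary using (¬_; yes; no)

ι : ℕ → ℚ
ι n = + n ℚ./ 1

_^ℚ_ : ℚ → ℕ → ℚ
q ^ℚ zero  = 1ℚ
q ^ℚ suc k = q * (q ^ℚ k)

-- total inverse on ℚ (inv 0 = 0; only used at nonzero arguments)
inv : ℚ → ℚ
inv q with q ≟ 0ℚ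
... | yes _ = 0ℚ
... | no q≢0 = 1/_ q {{≢-nonZero q≢0}}

-- rStir r d k = { r + d  brace  k }_r  (r-Stirling numbers of the second kind),
-- via the standard recurrence (Broder):
--   { r brace k }_r = [k = r],
--   { n brace k }_r = k { n-1 brace k }_r + { n-1 brace k-1 }_r   (n > r).
rStir : ℕ → ℕ → ℕ → ℕ
rStir r zero    k       = if k ≡ᵇ r then 1 else 0
rStir r (suc d) zero    = 0 ℕ.* rStir r d zero
rStir r (suc d) (suc k) = suc k ℕ.* rStir r d (suc k) ℕ.+ rStir r d k

-- coefficient of x^j in F_n(x; r, s) = Σ_{k=0}^n {n+r brace k+r}_r (k+s)! x^k
fubiniCoeff : ℕ → ℕ → ℕ → ℕ → ℕ
fubiniCoeff r s n j = if j ≤ᵇ n then rStir r n (j ℕ.+ r) ℕ.* (j ℕ.+ s) ! else 0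

Σ₁ : ℕ → (ℕ → ℚ) → ℚ
Σ₁ zero    f = 0ℚ
Σ₁ (suc N) f = Σ₁ N f + f (suc N)

-- q ∈ p ℤ_p  (for a rational q, ℚ ∩ pℤ_p = { a/b reduced : p ∣ a, p ∤ b })
InPZp : ℕ → ℚ → Set
InPZp p q = (p ∣ ℤ.∣ ↥ q ∣) × ¬ (p ∣ ↧ₙ q)
  where open import Data.Product using (_×_)

-- coefficient of x^j of  Σ_{k=1}^{p-1} F_{n+k}(x;r,s) / (-m)^k
lhsCoeff : ℕ → ℕ → ℕ → ℕ → ℕ → ℕ → ℚ
lhsCoeff p n m r s j =
  Σ₁ (p ℕ.∸ 1) (λ k → ι (fubiniCoeff r s (n ℕ.+ k) j) * inv ((- ι m) ^ℚ k))

-- coefficient of x^j of  (-m)^n (F_{p-1}(x; r+m, s) - s!)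
rhsCoeff : ℕ → ℕ → ℕ → ℕ → ℕ → ℕ → ℚ
rhsCoeff p n m r s j =
  ((- ι m) ^ℚ n) * (ι (fubiniCoeff (r ℕ.+ m) s (p ℕ.∸ 1) j) - (if j ≡ᵇ 0 then ι (s !) else 0ℚ))

module Submission where

-- Write M = -m and S(N) = { N+r brace j+r }_r, so that [x^j]F_N(x;r,s) = (j+s)! S(N).
-- The proof rests on the explicit formula  j! S(N) = Δʲ[(r+i)^N](0)  (forward differences
-- in i), which reduces everything to pure powers a^N with a = r + i.  For those, Fermat's
-- little theorem and the geometric sum give the key congruence
--   Σ_{k=1}^{p-1} a^(n+k) M^(p-1-k)  ≡  M^(p-1) M^n ((a - M)^(p-1) - 1)      (mod p),
-- both sides being -M^n if a ≡ M and 0 otherwise.  Since Δʲ and the Horner sums are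
-- linear, j! times the two sides of the theorem (cleared of denominators by M^(p-1)) agree
-- mod p, hence so do (j+s)! times them, which are the integers in question.

open import Data.Nat as ℕ using (ℕ; zero; suc; _≡ᵇ_; _≤ᵇ_; _!)
open import Data.Integer as ℤ using (ℤ; +_)
import Data.Integer.Properties as ℤP
import Data.Nat.Properties as ℕP
import Data.Nat.Divisibility as ℕ∣
import Data.Integer.Divisibility.Signed as ℤ∣
import Data.Rational as ℚ
import Data.Nat.Tactic.RingSolver as ℕSolver
open import Data.Integer.Tactic.RingSolver using (solve-∀)
open import Data.Nat.Primality using (Prime; euclidsLemma; prime⇒nonTrivial)
open import Data.Bool using (true; false; T; if_then_else_)
open import Data.Unit using (tt)
open import Data.Product using (_,_)
open import Data.Sum using (_⊎_; inj₁; inj₂; [_,_]′)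
open import Data.Empty using (⊥-elim)
open import Relation.Nullary using (¬_; Dec; yes; no)
open import Relation.Binary.Bundles using (Setoid)
open import Relation.Binary.PropositionalEquality
  using (_≡_; _≢_; refl; sym; trans; cong; cong₂; subst; module ≡-Reasoning)
import Relation.Binary.Reasoning.Setoid as SetoidReasoning
open import Defs

module OverIntegers where
  open import Data.Integer using (_+_; _*_; -_; _-_; _^_)
  open ℤ∣ using (_∣_; divides)
  open import Data.Integer.DivMod using (a≡a%ℕn+[a/ℕn]*n; _%ℕ_; _/ℕ_)

  module Congruence (p : ℕ) where

    infix 4 _≈_
    record _≈_ (x y : ℤ) : Set where
      constructor mod-p
      field p∣difference : + p ∣ x - y
    open _≈_ public

    ∣-resp : ∀ {a b} → a ≡ b → + p ∣ a → + p ∣ b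
    ∣-resp = subst (+ p ∣_)

    p∣0 : + p ∣ + 0
    p∣0 = divides (+ 0) refl

    ≈-refl : ∀ {x} → x ≈ x
    ≈-refl {x} = mod-p (∣-resp (sym (ℤP.+-inverseʳ x)) p∣0)

    ≈-reflexive : ∀ {x y} → x ≡ y → x ≈ y
    ≈-reflexive refl = ≈-refl

    ≈-sym : ∀ {x y} → x ≈ y → y ≈ x
    ≈-sym {x} {y} (mod-p d) = mod-p (∣-resp (lemma x y) (ℤ∣.∣m⇒∣-m d))
      where lemma : ∀ x y → - (x - y) ≡ y - x
            lemma = solve-∀

    ≈-trans : ∀ {x y z} → x ≈ y → y ≈ z → x ≈ z
    ≈-trans {x} {y} {z} (mod-p d) (mod-p e) = mod-p (∣-resp (lemma x y z) (ℤ∣.∣m∣n⇒∣m+n d e))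
      where lemma : ∀ x y z → (x - y) + (y - z) ≡ x - z
            lemma = solve-∀

    ≈-setoid : Setoid _ _
    ≈-setoid = record
      { Carrier = ℤ ; _≈_ = _≈_
      ; isEquivalence = record { refl = ≈-refl ; sym = ≈-sym ; trans = ≈-trans } }

    module ≈-Reasoning = SetoidReasoning ≈-setoid

    +-cong : ∀ {x x′ y y′} → x ≈ x′ → y ≈ y′ → x + y ≈ x′ + y′
    +-cong {x} {x′} {y} {y′} (mod-p d) (mod-p e) =
      mod-p (∣-resp (lemma x x′ y y′) (ℤ∣.∣m∣n⇒∣m+n d e))
      where lemma : ∀ x x′ y y′ → (x - x′) + (y - y′) ≡ (x + y) - (x′ + y′)
            lemma = solve-∀

    -‿cong : ∀ {x x′} → x ≈ x′ → - x ≈ - x′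
    -‿cong {x} {x′} (mod-p d) = mod-p (∣-resp (lemma x x′) (ℤ∣.∣m⇒∣-m d))
      where lemma : ∀ x x′ → - (x - x′) ≡ (- x) - (- x′)
            lemma = solve-∀

    −-cong : ∀ {x x′ y y′} → x ≈ x′ → y ≈ y′ → x - y ≈ x′ - y′
    −-cong d e = +-cong d (-‿cong e)

    *-cong : ∀ {x x′ y y′} → x ≈ x′ → y ≈ y′ → x * y ≈ x′ * y′
    *-cong {x} {x′} {y} {y′} (mod-p d) (mod-p e) =
      mod-p (∣-resp (lemma x x′ y y′) (ℤ∣.∣m∣n⇒∣m+n (ℤ∣.∣n⇒∣m*n x e) (ℤ∣.∣n⇒∣m*n y′ d)))
      where lemma : ∀ x x′ y y′ → x * (y - y′) + y′ * (x - x′) ≡ x * y - x′ * y′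
            lemma = solve-∀

    ^-cong : ∀ {x y} n → x ≈ y → x ^ n ≈ y ^ n
    ^-cong zero    _ = ≈-refl
    ^-cong (suc n) d = *-cong d (^-cong n d)

    ∣⇒≈0 : ∀ {x} → + p ∣ x → x ≈ + 0
    ∣⇒≈0 {x} d = mod-p (∣-resp (sym (ℤP.+-identityʳ x)) d)

    ≈0⇒∣ : ∀ {x} → x ≈ + 0 → + p ∣ x
    ≈0⇒∣ {x} (mod-p d) = ∣-resp (ℤP.+-identityʳ x) d

    p≈0 : + p ≈ + 0
    p≈0 = ∣⇒≈0 ℤ∣.∣-refl

    ≈-residue : .{{_ : ℕ.NonZero p}} → ∀ a → a ≈ + (a %ℕ p)
    ≈-residue a = mod-p (∣-resp a-r≡kp (ℤ∣.∣n⇒∣m*n k ℤ∣.∣-refl))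
      where
        r = + (a %ℕ p)
        k = a /ℕ p
        ring : ∀ r k P → k * P ≡ (r + k * P) - r
        ring = solve-∀
        a-r≡kp : k * + p ≡ a - r
        a-r≡kp = trans (ring r k (+ p)) (cong (_- r) (sym (a≡a%ℕn+[a/ℕn]*n a p)))

    euclid : Prime p → ∀ x y → + p ∣ x * y → + p ∣ x ⊎ + p ∣ y
    euclid p-prime x y d
      with euclidsLemma ℤ.∣ x ∣ ℤ.∣ y ∣ p-prime (subst (p ℕ∣.∣_) (ℤP.abs-* x y) (ℤ∣.∣⇒∣ᵤ d))
    ... | inj₁ p∣x = inj₁ (ℤ∣.∣ᵤ⇒∣ p∣x)
    ... | inj₂ p∣y = inj₂ (ℤ∣.∣ᵤ⇒∣ p∣y)

    ∤-^ : Prime p → ∀ {a} → ¬ + p ∣ a → ∀ k → ¬ + p ∣ a ^ k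
    ∤-^ p-prime p∤a zero    p∣1 = ℕ.nonTrivial⇒≢1 {{prime⇒nonTrivial p-prime}} (ℕ∣.∣1⇒≡1 (ℤ∣.∣⇒∣ᵤ p∣1))
    ∤-^ p-prime {a} p∤a (suc k) p∣aᵏ⁺¹ = [ p∤a , ∤-^ p-prime p∤a k ]′ (euclid p-prime a (a ^ k) p∣aᵏ⁺¹)

  binom : ℕ → ℕ → ℕ
  binom n       zero    = 1
  binom zero    (suc k) = 0
  binom (suc n) (suc k) = binom n k ℕ.+ binom n (suc k)

  binom-above : ∀ n d → binom n (suc (n ℕ.+ d)) ≡ 0
  binom-above zero    d = refl
  binom-above (suc n) d rewrite binom-above n d =
    trans (cong (λ i → binom n (suc i)) (sym (ℕP.+-suc n d))) (binom-above n (suc d))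

  binom-diagonal : ∀ n → binom n n ≡ 1
  binom-diagonal zero    = refl
  binom-diagonal (suc n) =
    cong₂ ℕ._+_ (binom-diagonal n)
                (trans (cong (λ i → binom n (suc i)) (sym (ℕP.+-identityʳ n))) (binom-above n 0))

  -- The absorption identity (k+1)·C(n+1,k+1) = (n+1)·C(n,k); for n+1 = p prime
  -- it shows p ∣ C(p,k+1) whenever k+1 < p.
  binom-absorption : ∀ n k → suc k ℕ.* binom (suc n) (suc k) ≡ suc n ℕ.* binom n k
  binom-absorption zero    zero    = refl
  binom-absorption zero    (suc k) = ℕP.*-zeroʳ (suc (suc k))
  binom-absorption (suc n) zero    =
    trans (ℕP.*-identityˡ _) (cong suc (trans (sym (ℕP.*-identityˡ _)) (binom-absorption n zero)))
  binom-absorption (suc n) (suc k) = begin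
      suc (suc k) ℕ.* (b₁ ℕ.+ b₂)
        ≡⟨ distribute (suc k) b₁ b₂ ⟩
      (suc k ℕ.* b₁ ℕ.+ b₁) ℕ.+ suc (suc k) ℕ.* b₂
        ≡⟨ cong₂ (λ u v → (u ℕ.+ b₁) ℕ.+ v) (binom-absorption n k) (binom-absorption n (suc k)) ⟩
      (suc n ℕ.* binom n k ℕ.+ b₁) ℕ.+ suc n ℕ.* binom n (suc k)
        ≡⟨ collect (suc n) (binom n k) (binom n (suc k)) ⟩
      suc (suc n) ℕ.* b₁ ∎
    where
      open ≡-Reasoning
      b₁ = binom (suc n) (suc k)
      b₂ = binom (suc n) (suc (suc k))
      distribute : ∀ k b₁ b₂ → suc k ℕ.* (b₁ ℕ.+ b₂) ≡ (k ℕ.* b₁ ℕ.+ b₁) ℕ.+ suc k ℕ.* b₂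
      distribute = ℕSolver.solve-∀
      collect : ∀ a x y → (a ℕ.* x ℕ.+ (x ℕ.+ y)) ℕ.+ a ℕ.* y ≡ suc a ℕ.* (x ℕ.+ y)
      collect = ℕSolver.solve-∀

  ∑ : ℕ → (ℕ → ℤ) → ℤ
  ∑ zero    f = + 0
  ∑ (suc N) f = f 0 + ∑ N (λ k → f (suc k))

  ∑-cong : ∀ N {f g} → (∀ k → f k ≡ g k) → ∑ N f ≡ ∑ N g
  ∑-cong zero    f≡g = refl
  ∑-cong (suc N) f≡g = cong₂ _+_ (f≡g 0) (∑-cong N (λ k → f≡g (suc k)))

  ∑-snoc : ∀ N f → ∑ (suc N) f ≡ ∑ N f + f N
  ∑-snoc zero    f = trans (ℤP.+-identityʳ (f 0)) (sym (ℤP.+-identityˡ (f 0)))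
  ∑-snoc (suc N) f =
    trans (cong (_+_ (f 0)) (∑-snoc N (λ k → f (suc k))))
          (sym (ℤP.+-assoc (f 0) (∑ N (λ k → f (suc k))) (f (suc N))))

  ∑-+ : ∀ N f g → ∑ N (λ k → f k + g k) ≡ ∑ N f + ∑ N g
  ∑-+ zero    f g = refl
  ∑-+ (suc N) f g = trans (cong (_+_ (f 0 + g 0)) (∑-+ N _ _)) (interchange (f 0) (g 0) _ _)
    where interchange : ∀ a b c d → (a + b) + (c + d) ≡ (a + c) + (b + d)
          interchange = solve-∀

  ∑-scale : ∀ N c f → c * ∑ N f ≡ ∑ N (λ k → c * f k)
  ∑-scale zero    c f = ℤP.*-zeroʳ c
  ∑-scale (suc N) c f = trans (ℤP.*-distribˡ-+ c (f 0) _) (cong (_+_ (c * f 0)) (∑-scale N c _))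

  ∑-divisible : ∀ {d} N f → (∀ k → k ℕ.< N → d ∣ f k) → d ∣ ∑ N f
  ∑-divisible zero    f d∣f = divides (+ 0) refl
  ∑-divisible (suc N) f d∣f =
    ℤ∣.∣m∣n⇒∣m+n (d∣f 0 (ℕ.s≤s ℕ.z≤n)) (∑-divisible N _ (λ k k<N → d∣f (suc k) (ℕ.s≤s k<N)))

  binomial : ∀ a n → (+ 1 + a) ^ n ≡ ∑ (suc n) (λ k → + binom n k * a ^ k)
  binomial a zero    = refl
  binomial a (suc n) = begin
      (+ 1 + a) * (+ 1 + a) ^ n
        ≡⟨ cong ((+ 1 + a) *_) (binomial a n) ⟩
      (+ 1 + a) * S
        ≡⟨ split S a ⟩
      S + a * S
        ≡⟨ cong₂ _+_ (sym extend-top) (∑-scale (suc n) a term) ⟩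
      (term 0 + ∑ (suc n) (λ k → term (suc k))) + ∑ (suc n) (λ k → a * term k)
        ≡⟨ ℤP.+-assoc (term 0) (∑ (suc n) (λ k → term (suc k))) _ ⟩
      term 0 + (∑ (suc n) (λ k → term (suc k)) + ∑ (suc n) (λ k → a * term k))
        ≡⟨ cong (_+_ (term 0)) (sym (∑-+ (suc n) (λ k → term (suc k)) (λ k → a * term k))) ⟩
      term 0 + ∑ (suc n) (λ k → term (suc k) + a * term k)
        ≡⟨ cong (_+_ (term 0)) (∑-cong (suc n) pascal) ⟩
      ∑ (suc (suc n)) (λ k → + binom (suc n) k * a ^ k) ∎
    where
      open ≡-Reasoning
      term : ℕ → ℤ
      term k = + binom n k * a ^ k
      S = ∑ (suc n) term
      split : ∀ s a → (+ 1 + a) * s ≡ s + a * s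
      split = solve-∀
      -- the term of index n+1 vanishes, so the sum may be extended by it
      extend-top : term 0 + ∑ (suc n) (λ k → term (suc k)) ≡ S
      extend-top = cong (_+_ (term 0)) (begin
        ∑ (suc n) (λ k → term (suc k))     ≡⟨ ∑-snoc n (λ k → term (suc k)) ⟩
        ∑ n (λ k → term (suc k)) + term (suc n)
          ≡⟨ cong (λ b → ∑ n (λ k → term (suc k)) + + b * a ^ suc n)
                  (trans (cong (λ i → binom n (suc i)) (sym (ℕP.+-identityʳ n))) (binom-above n 0)) ⟩
        ∑ n (λ k → term (suc k)) + + 0     ≡⟨ ℤP.+-identityʳ _ ⟩
        ∑ n (λ k → term (suc k))           ∎)
      pascal : ∀ k → term (suc k) + a * term k ≡ + binom (suc n) (suc k) * a ^ suc k
      pascal k = trans (regroup (+ binom n (suc k)) (+ binom n k) a (a ^ k))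
                       (cong (_* a ^ suc k) (sym (ℤP.pos-+ (binom n k) (binom n (suc k)))))
        where regroup : ∀ x y a t → x * (a * t) + a * (y * t) ≡ (y + x) * (a * t)
              regroup = solve-∀

  module Fermat (q : ℕ) (p-prime : Prime (suc (suc q))) where

    p : ℕ
    p = suc (suc q)

    open Congruence p

    p∣binom : ∀ k → k ℕ.< suc q → p ℕ∣.∣ binom p (suc k)
    p∣binom k k<p-1
      with euclidsLemma (suc k) (binom p (suc k)) p-prime
             (subst (p ℕ∣.∣_) (sym (binom-absorption (suc q) k)) (ℕ∣.m∣m*n (binom (suc q) k)))
    ... | inj₂ p∣binom = p∣binom
    ... | inj₁ p∣k+1   = ⊥-elim (ℕP.<⇒≱ (ℕ.s≤s k<p-1) (ℕ∣.∣⇒≤ p∣k+1))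

    -- (1 + a)ᵖ ≡ 1 + aᵖ: all middle binomial coefficients vanish mod p.
    frobenius : ∀ a → (+ 1 + a) ^ p ≈ + 1 + a ^ p
    frobenius a = begin
        (+ 1 + a) ^ p
          ≡⟨ binomial a p ⟩
        + 1 * + 1 + ∑ (suc (suc q)) (λ k → term (suc k))
          ≡⟨ cong₂ _+_ (ℤP.*-identityˡ (+ 1)) (∑-snoc (suc q) (λ k → term (suc k))) ⟩
        + 1 + (∑ (suc q) (λ k → term (suc k)) + term p)
          ≈⟨ +-cong (≈-refl {+ 1}) (+-cong (∣⇒≈0 middle-terms) (≈-refl {term p})) ⟩
        + 1 + (+ 0 + term p)
          ≡⟨ cong (_+_ (+ 1)) (trans (ℤP.+-identityˡ (term p)) top-term) ⟩
        + 1 + a ^ p ∎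
      where
        open ≈-Reasoning
        term : ℕ → ℤ
        term k = + binom p k * a ^ k
        middle-terms : + p ∣ ∑ (suc q) (λ k → term (suc k))
        middle-terms = ∑-divisible (suc q) (λ k → term (suc k))
          (λ k k<p-1 → ℤ∣.∣m⇒∣m*n (a ^ suc k) (ℤ∣.∣ᵤ⇒∣ {+ p} {+ binom p (suc k)} (p∣binom k k<p-1)))
        top-term : term p ≡ a ^ p
        top-term = trans (cong (λ b → + b * a ^ p) (binom-diagonal p)) (ℤP.*-identityˡ (a ^ p))

    fermat-ℕ : ∀ n → (+ n) ^ p ≈ + n
    fermat-ℕ zero    = ≈-reflexive (ℤP.*-zeroˡ ((+ 0) ^ suc q))
    fermat-ℕ (suc n) = ≈-trans (frobenius (+ n)) (+-cong (≈-refl {+ 1}) (fermat-ℕ n))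

    fermat : ∀ a → a ^ p ≈ a
    fermat a = ≈-trans (^-cong {a} {+ r} p (≈-residue a)) (≈-trans (fermat-ℕ r) (≈-sym (≈-residue a)))
      where r = a %ℕ p

    fermat-unit : ∀ a → ¬ + p ∣ a → a ^ suc q ≈ + 1
    fermat-unit a p∤a = [ (λ p∣a → ⊥-elim (p∤a p∣a)) , mod-p ]′
      (euclid p-prime a (a ^ suc q - + 1) (∣-resp (factor a (a ^ suc q)) (p∣difference (fermat a))))
      where factor : ∀ a t → a * t - a ≡ a * (t - + 1)
            factor = solve-∀

    power-of-multiple : ∀ {a} k → + p ∣ a → a ^ suc k ≈ + 0
    power-of-multiple {a} k p∣a = ∣⇒≈0 (ℤ∣.∣m⇒∣m*n (a ^ k) p∣a)

  -- Horner sums: horner M N c = Σ_{k=1}^{N} c k · M^(N-k).  Multiplying the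
  -- left-hand side of the theorem by (-m)^(p-1) turns it into such a sum
  -- with M = -m.
  horner : ℤ → ℕ → (ℕ → ℤ) → ℤ
  horner M zero    c = + 0
  horner M (suc N) c = M * horner M N c + c (suc N)

  horner-cong : ∀ M N {c d} → (∀ k → c k ≡ d k) → horner M N c ≡ horner M N d
  horner-cong M zero    c≡d = refl
  horner-cong M (suc N) c≡d = cong₂ (λ h x → M * h + x) (horner-cong M N c≡d) (c≡d (suc N))

  horner-scale : ∀ M N a c → horner M N (λ k → a * c k) ≡ a * horner M N c
  horner-scale M zero    a c = sym (ℤP.*-zeroʳ a)
  horner-scale M (suc N) a c =
    trans (cong (λ h → M * h + a * c (suc N)) (horner-scale M N a c))
          (factor M a (horner M N c) (c (suc N)))
    where factor : ∀ M a h x → M * (a * h) + a * x ≡ a * (M * h + x)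
          factor = solve-∀

  module _ (p : ℕ) where
    open Congruence p

    horner-≈ : ∀ M N {c d} → (∀ k → c k ≈ d k) → horner M N c ≈ horner M N d
    horner-≈ M zero    c≈d = ≈-refl
    horner-≈ M (suc N) c≈d = +-cong (*-cong (≈-refl {M}) (horner-≈ M N c≈d)) (c≈d (suc N))

  horner-geometric : ∀ M a n N →
    (a - M) * horner M N (λ k → a ^ (n ℕ.+ k)) ≡ a ^ suc n * (a ^ N - M ^ N)
  horner-geometric M a n zero =
    trans (ℤP.*-zeroʳ (a - M))
          (sym (trans (cong (a ^ suc n *_) (ℤP.+-inverseʳ (+ 1))) (ℤP.*-zeroʳ (a ^ suc n))))
  horner-geometric M a n (suc N) = begin
      (a - M) * (M * H + a ^ (n ℕ.+ suc N))
        ≡⟨ cong (λ t → (a - M) * (M * H + t)) power-split ⟩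
      (a - M) * (M * H + A * X)
        ≡⟨ expand a M H A X ⟩
      M * ((a - M) * H) + (a - M) * A * X
        ≡⟨ cong (λ t → M * t + (a - M) * A * X) (horner-geometric M a n N) ⟩
      M * (A * (X - Y)) + (a - M) * A * X
        ≡⟨ collect a M A X Y ⟩
      A * (a * X - M * Y) ∎
    where
      open ≡-Reasoning
      H = horner M N (λ k → a ^ (n ℕ.+ k))
      A = a ^ suc n
      X = a ^ N
      Y = M ^ N
      power-split : a ^ (n ℕ.+ suc N) ≡ A * X
      power-split = trans (cong (a ^_) (ℕP.+-suc n N))
                    (trans (cong (a *_) (ℤP.^-distribˡ-+-* a n N)) (sym (ℤP.*-assoc a (a ^ n) X)))
      expand : ∀ a M h A X → (a - M) * (M * h + A * X) ≡ M * ((a - M) * h) + (a - M) * A * X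
      expand = solve-∀
      collect : ∀ a M A X Y → M * (A * (X - Y)) + (a - M) * A * X ≡ A * (a * X - M * Y)
      collect = solve-∀

  horner-powers : ∀ M n N → horner M N (λ k → M ^ (n ℕ.+ k)) ≡ + N * M ^ (n ℕ.+ N)
  horner-powers M n zero    = refl
  horner-powers M n (suc N) = begin
      M * horner M N (λ k → M ^ (n ℕ.+ k)) + M ^ (n ℕ.+ suc N)
        ≡⟨ cong₂ (λ h t → M * h + t) (horner-powers M n N) (cong (M ^_) (ℕP.+-suc n N)) ⟩
      M * (+ N * Z) + M * Z
        ≡⟨ collect M (+ N) Z ⟩
      (+ 1 + + N) * (M * Z)
        ≡⟨ cong₂ _*_ (sym (ℤP.pos-+ 1 N)) (cong (M ^_) (sym (ℕP.+-suc n N))) ⟩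
      + suc N * M ^ (n ℕ.+ suc N) ∎
    where
      open ≡-Reasoning
      Z = M ^ (n ℕ.+ N)
      collect : ∀ M N Z → M * (N * Z) + M * Z ≡ (+ 1 + N) * (M * Z)
      collect = solve-∀

  -- The forward difference operator: Δ j φ = (Δʲ φ)(0), with Δφ(i) = φ(i+1) - φ(i).
  Δ : ℕ → (ℕ → ℤ) → ℤ
  Δ zero    φ = φ 0
  Δ (suc j) φ = Δ j (λ i → φ (suc i)) - Δ j φ

  Δ-cong : ∀ j {φ χ} → (∀ i → φ i ≡ χ i) → Δ j φ ≡ Δ j χ
  Δ-cong zero    φ≡χ = φ≡χ 0
  Δ-cong (suc j) φ≡χ = cong₂ _-_ (Δ-cong j (λ i → φ≡χ (suc i))) (Δ-cong j φ≡χ)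

  Δ-+ : ∀ j φ χ → Δ j (λ i → φ i + χ i) ≡ Δ j φ + Δ j χ
  Δ-+ zero    φ χ = refl
  Δ-+ (suc j) φ χ =
    trans (cong₂ _-_ (Δ-+ j (λ i → φ (suc i)) (λ i → χ (suc i))) (Δ-+ j φ χ))
          (interchange (Δ j (λ i → φ (suc i))) (Δ j (λ i → χ (suc i))) (Δ j φ) (Δ j χ))
    where interchange : ∀ a b c d → (a + b) - (c + d) ≡ (a - c) + (b - d)
          interchange = solve-∀

  Δ-− : ∀ j φ χ → Δ j (λ i → φ i - χ i) ≡ Δ j φ - Δ j χ
  Δ-− zero    φ χ = refl
  Δ-− (suc j) φ χ =
    trans (cong₂ _-_ (Δ-− j (λ i → φ (suc i)) (λ i → χ (suc i))) (Δ-− j φ χ))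
          (interchange (Δ j (λ i → φ (suc i))) (Δ j (λ i → χ (suc i))) (Δ j φ) (Δ j χ))
    where interchange : ∀ a b c d → (a - b) - (c - d) ≡ (a - c) - (b - d)
          interchange = solve-∀

  Δ-scale : ∀ j c φ → Δ j (λ i → c * φ i) ≡ c * Δ j φ
  Δ-scale zero    c φ = refl
  Δ-scale (suc j) c φ =
    trans (cong₂ _-_ (Δ-scale j c (λ i → φ (suc i))) (Δ-scale j c φ))
          (factor c (Δ j (λ i → φ (suc i))) (Δ j φ))
    where factor : ∀ c a b → c * a - c * b ≡ c * (a - b)
          factor = solve-∀

  Δ-const : ∀ j c → Δ (suc j) (λ _ → c) ≡ + 0
  Δ-const zero    c = ℤP.+-inverseʳ c
  Δ-const (suc j) c = cong₂ _-_ (Δ-const j c) (Δ-const j c)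

  Δ-horner : ∀ j M N (φ : ℕ → ℕ → ℤ) →
    Δ j (λ i → horner M N (φ i)) ≡ horner M N (λ k → Δ j (λ i → φ i k))
  Δ-horner zero    M N       φ = refl
  Δ-horner (suc j) M zero    φ = Δ-const j (+ 0)
  Δ-horner (suc j) M (suc N) φ = begin
      Δ (suc j) (λ i → M * horner M N (φ i) + φ i (suc N))
        ≡⟨ Δ-+ (suc j) (λ i → M * horner M N (φ i)) (λ i → φ i (suc N)) ⟩
      Δ (suc j) (λ i → M * horner M N (φ i)) + Δ (suc j) (λ i → φ i (suc N))
        ≡⟨ cong (_+ Δ (suc j) (λ i → φ i (suc N)))
                (trans (Δ-scale (suc j) M (λ i → horner M N (φ i))) (cong (M *_) (Δ-horner (suc j) M N φ))) ⟩
      M * horner M N (λ k → Δ (suc j) (λ i → φ i k)) + Δ (suc j) (λ i → φ i (suc N)) ∎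
    where open ≡-Reasoning

  module _ (p : ℕ) where
    open Congruence p

    Δ-≈ : ∀ j {φ χ} → (∀ i → φ i ≈ χ i) → Δ j φ ≈ Δ j χ
    Δ-≈ zero    φ≈χ = φ≈χ 0
    Δ-≈ (suc j) φ≈χ = −-cong (Δ-≈ j (λ i → φ≈χ (suc i))) (Δ-≈ j φ≈χ)

  Δ-leibniz : ∀ j x φ →
    Δ (suc j) (λ i → (x + + i) * φ i) ≡ x * Δ (suc j) φ + + suc j * Δ j (λ i → φ (suc i))
  Δ-leibniz zero    x φ = ring x (φ 1) (φ 0)
    where ring : ∀ x a b → (x + + 1) * a - (x + + 0) * b ≡ x * (a - b) + + 1 * a
          ring = solve-∀
  Δ-leibniz (suc j) x φ = begin
      Δ (suc j) (λ i → (x + + suc i) * φ (suc i)) - Δ (suc j) (λ i → (x + + i) * φ i)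
        ≡⟨ cong (_- Δ (suc j) (λ i → (x + + i) * φ i))
                (Δ-cong (suc j) (λ i → cong (_* φ (suc i)) (sym (ℤP.+-assoc x (+ 1) (+ i))))) ⟩
      Δ (suc j) (λ i → ((x + + 1) + + i) * φ (suc i)) - Δ (suc j) (λ i → (x + + i) * φ i)
        ≡⟨ cong₂ _-_ (Δ-leibniz j (x + + 1) (λ i → φ (suc i))) (Δ-leibniz j x φ) ⟩
      ((x + + 1) * (c - d) + s * c) - (x * b + s * d)
        ≡⟨ collect x s c d b ⟩
      x * ((c - d) - b) + (+ 1 + s) * (c - d) ∎
    where
      open ≡-Reasoning
      s = + suc j
      c = Δ j (λ i → φ (suc (suc i)))
      d = Δ j (λ i → φ (suc i))
      b = Δ (suc j) φ
      collect : ∀ x s c d b →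
        (x + + 1) * (c - d) + s * c - (x * b + s * d) ≡ x * ((c - d) - b) + (+ 1 + s) * (c - d)
      collect = solve-∀

  -- r-Stirling numbers in the normalisation used by the Fubini polynomials:
  -- stirling r j N = { N + r  brace  j + r }_r.
  stirling : ℕ → ℕ → ℕ → ℕ
  stirling r j N = rStir r N (j ℕ.+ r)

  rStir-initial : ∀ r k → k ≢ r → rStir r 0 k ≡ 0
  rStir-initial r k k≢r with k ≡ᵇ r in eq
  ... | false = refl
  ... | true  = ⊥-elim (k≢r (ℕP.≡ᵇ⇒≡ k r (subst T (sym eq) tt)))

  rStir-above : ∀ r d k → d ℕ.+ r ℕ.< k → rStir r d k ≡ 0
  rStir-above r zero    k       r<k = rStir-initial r k (λ k≡r → ℕP.<-irrefl (sym k≡r) r<k)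
  rStir-above r (suc d) zero    _   = refl
  rStir-above r (suc d) (suc k) (ℕ.s≤s d+r<k)
    rewrite rStir-above r d (suc k) (ℕP.m<n⇒m<1+n d+r<k) | rStir-above r d k d+r<k =
    trans (ℕP.+-identityʳ (k ℕ.* 0)) (ℕP.*-zeroʳ k)

  rStir-below : ∀ r d k → k ℕ.< r → rStir r d k ≡ 0
  rStir-below r zero    k       k<r = rStir-initial r k (λ k≡r → ℕP.<-irrefl k≡r k<r)
  rStir-below r (suc d) zero    _   = refl
  rStir-below r (suc d) (suc k) k<r
    rewrite rStir-below r d (suc k) k<r | rStir-below r d k (ℕP.<-trans (ℕP.n<1+n k) k<r) =
    trans (ℕP.+-identityʳ (k ℕ.* 0)) (ℕP.*-zeroʳ k)

  stirling-initial : ∀ r → stirling r 0 0 ≡ 1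
  stirling-initial r = cong (λ b → if b then 1 else 0) (≡ᵇ-refl r)
    where ≡ᵇ-refl : ∀ r → (r ≡ᵇ r) ≡ true
          ≡ᵇ-refl zero    = refl
          ≡ᵇ-refl (suc r) = ≡ᵇ-refl r

  stirling-zero : ∀ r N → stirling r 0 (suc N) ≡ r ℕ.* stirling r 0 N
  stirling-zero zero    N = refl
  stirling-zero (suc r) N =
    trans (cong (suc r ℕ.* rStir (suc r) N (suc r) ℕ.+_) (rStir-below (suc r) N r (ℕP.n<1+n r)))
          (ℕP.+-identityʳ _)

  -- The explicit formula  j! · { N+r brace j+r }_r = Δʲ[(r + i)^N](0),
  -- proved by induction on N from the triangular recurrence and Δ-leibniz.
  explicit : ∀ r j N → + (j !) * + stirling r j N ≡ Δ j (λ i → (+ r + + i) ^ N)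
  explicit r zero    zero    = cong (λ z → + 1 * + z) (stirling-initial r)
  explicit r (suc j) zero    =
    trans (cong (λ z → + (suc j !) * + z) (rStir-above r 0 (suc j ℕ.+ r) (ℕ.s≤s (ℕP.m≤n+m r j))))
          (trans (ℤP.*-zeroʳ (+ (suc j !))) (sym (Δ-const j (+ 1))))
  explicit r zero    (suc N) = begin
      + 1 * + stirling r 0 (suc N)
        ≡⟨ ℤP.*-identityˡ _ ⟩
      + stirling r 0 (suc N)
        ≡⟨ trans (cong +_ (stirling-zero r N)) (ℤP.pos-* r (stirling r 0 N)) ⟩
      + r * + stirling r 0 N
        ≡⟨ cong₂ _*_ (sym (ℤP.+-identityʳ (+ r))) (trans (sym (ℤP.*-identityˡ _)) (explicit r zero N)) ⟩
      (+ r + + 0) ^ suc N ∎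
    where open ≡-Reasoning
  explicit r (suc j) (suc N) = begin
      + (suc j !) * + stirling r (suc j) (suc N)
        ≡⟨ cong₂ _*_ (ℤP.pos-* (suc j) (j !)) recurrence ⟩
      (s * J) * ((x + s) * S₁ + S₀)
        ≡⟨ regroup x s J S₁ S₀ ⟩
      x * ((s * J) * S₁) + s * ((s * J) * S₁ + J * S₀)
        ≡⟨ cong₂ (λ u v → x * u + s * (u + v))
                 (trans (cong (_* S₁) (sym (ℤP.pos-* (suc j) (j !)))) (explicit r (suc j) N))
                 (explicit r j N) ⟩
      x * Δ (suc j) ψ + s * (Δ (suc j) ψ + Δ j ψ)
        ≡⟨ cong (λ t → x * Δ (suc j) ψ + s * t) (cancel (Δ j (λ i → ψ (suc i))) (Δ j ψ)) ⟩
      x * Δ (suc j) ψ + s * Δ j (λ i → ψ (suc i))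
        ≡⟨ Δ-leibniz j x ψ ⟨
      Δ (suc j) (λ i → (x + + i) ^ suc N) ∎
    where
      open ≡-Reasoning
      x = + r
      s = + suc j
      J = + (j !)
      S₁ = + stirling r (suc j) N
      S₀ = + stirling r j N
      ψ : ℕ → ℤ
      ψ i = (x + + i) ^ N
      recurrence : + stirling r (suc j) (suc N) ≡ (x + s) * S₁ + S₀
      recurrence = trans (ℤP.pos-+ _ (stirling r j N))
        (cong (_+ S₀) (trans (ℤP.pos-* (suc (j ℕ.+ r)) _)
          (cong (_* S₁) (trans (ℤP.pos-+ (suc j) r) (ℤP.+-comm s x)))))
      regroup : ∀ x s J S₁ S₀ →
        (s * J) * ((x + s) * S₁ + S₀) ≡ x * ((s * J) * S₁) + s * ((s * J) * S₁ + J * S₀)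
      regroup = solve-∀
      cancel : ∀ a b → (a - b) + b ≡ a
      cancel = solve-∀

  -- Coefficientwise, F_N(x;r,s) has x^j-coefficient { N+r brace j+r }_r (j+s)!;
  -- the range condition j ≤ N is automatic since the Stirling number vanishes.
  fubiniCoeff-stirling : ∀ r s N j → fubiniCoeff r s N j ≡ stirling r j N ℕ.* (j ℕ.+ s) !
  fubiniCoeff-stirling r s N j with j ≤ᵇ N in eq
  ... | true  = refl
  ... | false = sym (cong (ℕ._* (j ℕ.+ s) !) (rStir-above r N (j ℕ.+ r) (ℕP.+-monoˡ-< r N<j)))
    where
      N<j : N ℕ.< j
      N<j = ℕP.≰⇒> (λ j≤N → subst T eq (ℕP.≤⇒≤ᵇ j≤N))

  fubiniCoeff-ℤ : ∀ r s N j → + fubiniCoeff r s N j ≡ + ((j ℕ.+ s) !) * + stirling r j N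
  fubiniCoeff-ℤ r s N j =
    trans (cong +_ (trans (fubiniCoeff-stirling r s N j) (ℕP.*-comm (stirling r j N) ((j ℕ.+ s) !))))
          (ℤP.pos-* ((j ℕ.+ s) !) (stirling r j N))

  -- Kronecker delta at 0; s! · δ₀ j is the coefficient of x^j in the constant s!.
  δ₀ : ℕ → ℤ
  δ₀ zero    = + 1
  δ₀ (suc j) = + 0

  -- j! δ₀(j) = Δʲ[1](0): the explicit formula for the constant polynomial 1.
  Δ-one : ∀ j → + (j !) * δ₀ j ≡ Δ j (λ _ → + 1)
  Δ-one zero    = refl
  Δ-one (suc j) = trans (ℤP.*-zeroʳ (+ (suc j !))) (sym (Δ-const j (+ 1)))

  module IntegerCongruence (q : ℕ) (p-prime : Prime (suc (suc q))) (m : ℕ)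
                           (p∤m : ¬ (suc (suc q) ℕ∣.∣ m)) where
    open Fermat q p-prime
    open Congruence p

    M : ℤ
    M = - + m

    p∤M : ¬ + p ∣ M
    p∤M p∣M = p∤m (subst (p ℕ∣.∣_) (ℤP.∣-i∣≡∣i∣ (+ m)) (ℤ∣.∣⇒∣ᵤ p∣M))

    -- For a ≡ M the sum Σ_{k=1}^{p-1} a^(n+k) M^(p-1-k) has p-1 equal terms M^(n+p-1).
    power-sum-≡M : ∀ n a → + p ∣ a - M → horner M (suc q) (λ k → a ^ (n ℕ.+ k)) ≈ - M ^ n
    power-sum-≡M n a p∣a-M = begin
        horner M (suc q) (λ k → a ^ (n ℕ.+ k))
          ≈⟨ horner-≈ p M (suc q) (λ k → ^-cong (n ℕ.+ k) (mod-p p∣a-M)) ⟩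
        horner M (suc q) (λ k → M ^ (n ℕ.+ k))
          ≡⟨ horner-powers M n (suc q) ⟩
        + suc q * M ^ (n ℕ.+ suc q)
          ≡⟨ cong₂ _*_ (p-1 (+ suc q)) (ℤP.^-distribˡ-+-* M n (suc q)) ⟩
        (+ p - + 1) * (M ^ n * M ^ suc q)
          ≈⟨ *-cong (−-cong p≈0 (≈-refl {+ 1})) (*-cong (≈-refl {M ^ n}) (fermat-unit M p∤M)) ⟩
        (+ 0 - + 1) * (M ^ n * + 1)
          ≡⟨ simplify (M ^ n) ⟩
        - M ^ n ∎
      where
        open ≈-Reasoning
        p-1 : ∀ x → x ≡ (+ 1 + x) - + 1
        p-1 = solve-∀
        simplify : ∀ x → (+ 0 - + 1) * (x * + 1) ≡ - x
        simplify = solve-∀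

    -- For a ≢ M the geometric sum equals a^(n+1)(a^(p-1) - M^(p-1))/(a - M) ≡ 0.
    power-sum-≢M : ∀ n a → ¬ + p ∣ a - M → horner M (suc q) (λ k → a ^ (n ℕ.+ k)) ≈ + 0
    power-sum-≢M n a p∤a-M = [ (λ p∣a-M → ⊥-elim (p∤a-M p∣a-M)) , ∣⇒≈0 ]′
      (euclid p-prime (a - M) H (≈0⇒∣ (≈-trans (≈-reflexive (horner-geometric M a n (suc q))) (numerator≈0 (+ p ℤ∣.∣? a)))))
      where
        H = horner M (suc q) (λ k → a ^ (n ℕ.+ k))
        vanish : ∀ x → x * (+ 1 - + 1) ≡ + 0
        vanish = solve-∀
        numerator≈0 : Dec (+ p ∣ a) → a ^ suc n * (a ^ suc q - M ^ suc q) ≈ + 0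
        numerator≈0 (yes p∣a) = *-cong (power-of-multiple n p∣a) ≈-refl
        numerator≈0 (no  p∤a) = ≈-trans (*-cong (≈-refl {a ^ suc n}) (−-cong (fermat-unit a p∤a) (fermat-unit M p∤M)))
                                        (≈-reflexive (vanish (a ^ suc n)))

    shifted-≡M : ∀ n a → + p ∣ a - M → M ^ suc q * (M ^ n * ((a - M) ^ suc q - + 1)) ≈ - M ^ n
    shifted-≡M n a p∣a-M = begin
        M ^ suc q * (M ^ n * ((a - M) ^ suc q - + 1))
          ≈⟨ *-cong (fermat-unit M p∤M) (*-cong (≈-refl {M ^ n}) (−-cong (power-of-multiple q p∣a-M) (≈-refl {+ 1}))) ⟩
        + 1 * (M ^ n * (+ 0 - + 1))
          ≡⟨ simplify (M ^ n) ⟩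
        - M ^ n ∎
      where
        open ≈-Reasoning
        simplify : ∀ x → + 1 * (x * (+ 0 - + 1)) ≡ - x
        simplify = solve-∀

    shifted-≢M : ∀ n a → ¬ + p ∣ a - M → M ^ suc q * (M ^ n * ((a - M) ^ suc q - + 1)) ≈ + 0
    shifted-≢M n a p∤a-M = begin
        M ^ suc q * (M ^ n * ((a - M) ^ suc q - + 1))
          ≈⟨ *-cong (fermat-unit M p∤M) (*-cong (≈-refl {M ^ n}) (−-cong (fermat-unit (a - M) p∤a-M) (≈-refl {+ 1}))) ⟩
        + 1 * (M ^ n * (+ 1 - + 1))
          ≡⟨ simplify (M ^ n) ⟩
        + 0 ∎
      where
        open ≈-Reasoning
        simplify : ∀ x → + 1 * (x * (+ 1 - + 1)) ≡ + 0
        simplify = solve-∀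

    power-sum : ∀ n a →
      horner M (suc q) (λ k → a ^ (n ℕ.+ k)) ≈ M ^ suc q * (M ^ n * ((a - M) ^ suc q - + 1))
    power-sum n a with + p ℤ∣.∣? a - M
    ... | yes p∣a-M = ≈-trans (power-sum-≡M n a p∣a-M) (≈-sym (shifted-≡M n a p∣a-M))
    ... | no  p∤a-M = ≈-trans (power-sum-≢M n a p∤a-M) (≈-sym (shifted-≢M n a p∤a-M))

    -- Both sides of the theorem for the Stirling part of the coefficient of x^j.
    stirling-sum : ℕ → ℕ → ℕ → ℤ
    stirling-sum r j n = horner M (suc q) (λ k → + stirling r j (n ℕ.+ k))

    shifted-stirling : ℕ → ℕ → ℕ → ℤ
    shifted-stirling r j n = M ^ suc q * (M ^ n * (+ stirling (r ℕ.+ m) j (suc q) - δ₀ j))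

    -- The common value, up to the factor j!, of both sides modulo p.
    Δ-shifted : ℕ → ℕ → ℕ → ℤ
    Δ-shifted r j n = Δ j (λ i → M ^ suc q * (M ^ n * (((+ r + + i) - M) ^ suc q - + 1)))

    stirling-sum-≈ : ∀ r j n → + (j !) * stirling-sum r j n ≈ Δ-shifted r j n
    stirling-sum-≈ r j n = begin
        + (j !) * stirling-sum r j n
          ≡⟨ horner-scale M (suc q) (+ (j !)) (λ k → + stirling r j (n ℕ.+ k)) ⟨
        horner M (suc q) (λ k → + (j !) * + stirling r j (n ℕ.+ k))
          ≡⟨ horner-cong M (suc q) (λ k → explicit r j (n ℕ.+ k)) ⟩
        horner M (suc q) (λ k → Δ j (λ i → (+ r + + i) ^ (n ℕ.+ k)))
          ≡⟨ Δ-horner j M (suc q) (λ i k → (+ r + + i) ^ (n ℕ.+ k)) ⟨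
        Δ j (λ i → horner M (suc q) (λ k → (+ r + + i) ^ (n ℕ.+ k)))
          ≈⟨ Δ-≈ p j (λ i → power-sum n (+ r + + i)) ⟩
        Δ-shifted r j n ∎
      where open ≈-Reasoning

    shifted-stirling-≡ : ∀ r j n → + (j !) * shifted-stirling r j n ≡ Δ-shifted r j n
    shifted-stirling-≡ r j n = begin
        + (j !) * shifted-stirling r j n
          ≡⟨ distribute (+ (j !)) A B (+ stirling (r ℕ.+ m) j (suc q)) (δ₀ j) ⟩
        A * (B * (+ (j !) * + stirling (r ℕ.+ m) j (suc q) - + (j !) * δ₀ j))
          ≡⟨ cong₂ (λ u v → A * (B * (u - v))) (explicit (r ℕ.+ m) j (suc q)) (Δ-one j) ⟩
        A * (B * (Δ j ψ - Δ j (λ _ → + 1)))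
          ≡⟨ cong (λ t → A * (B * t)) (Δ-− j ψ (λ _ → + 1)) ⟨
        A * (B * Δ j (λ i → ψ i - + 1))
          ≡⟨ trans (Δ-scale j A _) (cong (A *_) (Δ-scale j B _)) ⟨
        Δ j (λ i → A * (B * (ψ i - + 1)))
          ≡⟨ Δ-cong j (λ i → cong (λ x → A * (B * (x ^ suc q - + 1))) (shift i)) ⟩
        Δ-shifted r j n ∎
      where
        open ≡-Reasoning
        A = M ^ suc q
        B = M ^ n
        ψ : ℕ → ℤ
        ψ i = (+ (r ℕ.+ m) + + i) ^ suc q
        distribute : ∀ x A B g e → x * (A * (B * (g - e))) ≡ A * (B * (x * g - x * e))
        distribute = solve-∀
        shift : ∀ i → + (r ℕ.+ m) + + i ≡ (+ r + + i) - M
        shift i = trans (cong (_+ + i) (ℤP.pos-+ r m)) (ring (+ r) (+ m) (+ i))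
          where ring : ∀ r m i → (r + m) + i ≡ (r + i) - (- m)
                ring = solve-∀

    -- The two sides of the theorem's x^j-coefficient, multiplied by M^(p-1) (so integral):
    -- Σ_{k=1}^{p-1} [x^j]F_{n+k}(x;r,s) M^(p-1-k)  and  M^(p-1) M^n ([x^j]F_{p-1}(x;r+m,s) - [j = 0] s!).
    lhs-integer : ℕ → ℕ → ℕ → ℕ → ℤ
    lhs-integer r s n j = horner M (suc q) (λ k → + fubiniCoeff r s (n ℕ.+ k) j)

    rhs-integer : ℕ → ℕ → ℕ → ℕ → ℤ
    rhs-integer r s n j =
      M ^ suc q * (M ^ n * (+ fubiniCoeff (r ℕ.+ m) s (suc q) j - + ((j ℕ.+ s) !) * δ₀ j))

    -- Both sides carry the factor (j+s)! = t · j! in front of their Stirling parts.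
    fubini-difference : ∀ r s n j t → (j ℕ.+ s) ! ≡ t ℕ.* j ! →
      lhs-integer r s n j - rhs-integer r s n j
        ≡ + t * (+ (j !) * stirling-sum r j n - + (j !) * shifted-stirling r j n)
    fubini-difference r s n j t [j+s]!≡t*j! = begin
        lhs-integer r s n j - rhs-integer r s n j
          ≡⟨ cong₂ (λ u v → u - M ^ suc q * (M ^ n * (v - F * δ₀ j)))
                   (trans (horner-cong M (suc q) (λ k → fubiniCoeff-ℤ r s (n ℕ.+ k) j))
                          (horner-scale M (suc q) F (λ k → + stirling r j (n ℕ.+ k))))
                   (fubiniCoeff-ℤ (r ℕ.+ m) s (suc q) j) ⟩
        F * L - A * (B * (F * S - F * δ₀ j))
          ≡⟨ cong (λ f → f * L - A * (B * (f * S - f * δ₀ j))) F≡tJ ⟩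
        + t * J * L - A * (B * (+ t * J * S - + t * J * δ₀ j))
          ≡⟨ factor (+ t) J L A B S (δ₀ j) ⟩
        + t * (J * L - J * shifted-stirling r j n) ∎
      where
        open ≡-Reasoning
        F = + ((j ℕ.+ s) !)
        J = + (j !)
        L = stirling-sum r j n
        S = + stirling (r ℕ.+ m) j (suc q)
        A = M ^ suc q
        B = M ^ n
        F≡tJ : F ≡ + t * J
        F≡tJ = trans (cong +_ [j+s]!≡t*j!) (ℤP.pos-* t (j !))
        factor : ∀ t J L A B S d →
          t * J * L - A * (B * (t * J * S - t * J * d)) ≡ t * (J * L - J * (A * (B * (S - d))))
        factor = solve-∀

    fubini-congruence : ∀ r s n j → + p ∣ lhs-integer r s n j - rhs-integer r s n j
    fubini-congruence r s n j =
      ∣-resp (sym (fubini-difference r s n j t (ℕ∣._∣_.equality j!∣[j+s]!)))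
             (ℤ∣.∣n⇒∣m*n (+ t) (p∣difference j!-multiples-≈))
      where
        j!∣[j+s]! : j ! ℕ∣.∣ (j ℕ.+ s) !
        j!∣[j+s]! = ℕ∣.m≤n⇒m!∣n! (ℕP.m≤m+n j s)
        t = ℕ∣._∣_.quotient j!∣[j+s]!
        j!-multiples-≈ : + (j !) * stirling-sum r j n ≈ + (j !) * shifted-stirling r j n
        j!-multiples-≈ = ≈-trans (stirling-sum-≈ r j n) (≈-sym (≈-reflexive (shifted-stirling-≡ r j n)))

-- Part II: transfer of the integer congruence to the rational coefficients of Defs.
module OverRationals where
  open import Data.Rational using (ℚ; mkℚ; 0ℚ; 1ℚ; _+_; _*_; _-_; -_; toℚᵘ)
  import Data.Rational.Properties as ℚP
  open import Data.Rational.Unnormalised as ℚᵘ using (mkℚᵘ; *≡*)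
  import Data.Rational.Unnormalised.Properties as ℚᵘP
  open import Data.Rational.Solver using (module +-*-Solver)
  open +-*-Solver using (solve; _:+_; _:*_; _:=_)
  import Data.Nat.Coprimality as Coprimality
  open OverIntegers

  toℚ : ℤ → ℚ
  toℚ z = z ℚ./ 1

  toℚᵘ-toℚ : ∀ z → toℚᵘ (toℚ z) ℚᵘ.≃ mkℚᵘ z 0
  toℚᵘ-toℚ z = ℚP.toℚᵘ-fromℚᵘ (mkℚᵘ z 0)

  toℚ-+ : ∀ a b → toℚ (a ℤ.+ b) ≡ toℚ a + toℚ b
  toℚ-+ a b = ℚP.toℚᵘ-injective (ℚᵘP.≃-trans (toℚᵘ-toℚ (a ℤ.+ b)) (ℚᵘP.≃-trans (*≡* (ring a b))
    (ℚᵘP.≃-sym (ℚᵘP.≃-trans (ℚP.toℚᵘ-homo-+ (toℚ a) (toℚ b)) (ℚᵘP.+-cong (toℚᵘ-toℚ a) (toℚᵘ-toℚ b))))))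
    where ring : ∀ a b → (a ℤ.+ b) ℤ.* + 1 ≡ (a ℤ.* + 1 ℤ.+ b ℤ.* + 1) ℤ.* + 1
          ring = solve-∀

  toℚ-* : ∀ a b → toℚ (a ℤ.* b) ≡ toℚ a * toℚ b
  toℚ-* a b = ℚP.toℚᵘ-injective (ℚᵘP.≃-trans (toℚᵘ-toℚ (a ℤ.* b)) (ℚᵘP.≃-trans (*≡* refl)
    (ℚᵘP.≃-sym (ℚᵘP.≃-trans (ℚP.toℚᵘ-homo-* (toℚ a) (toℚ b)) (ℚᵘP.*-cong (toℚᵘ-toℚ a) (toℚᵘ-toℚ b))))))

  toℚ-neg : ∀ a → toℚ (ℤ.- a) ≡ - toℚ a
  toℚ-neg a = ℚP.toℚᵘ-injective (ℚᵘP.≃-trans (toℚᵘ-toℚ (ℤ.- a))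
    (ℚᵘP.≃-sym (ℚᵘP.≃-trans (ℚP.toℚᵘ-homo‿- (toℚ a)) (ℚᵘP.-‿cong (toℚᵘ-toℚ a)))))

  toℚ-− : ∀ a b → toℚ (a ℤ.- b) ≡ toℚ a - toℚ b
  toℚ-− a b = trans (toℚ-+ a (ℤ.- b)) (cong (_+_ (toℚ a)) (toℚ-neg b))

  toℚ-^ : ∀ a k → toℚ a ^ℚ k ≡ toℚ (a ℤ.^ k)
  toℚ-^ a zero    = refl
  toℚ-^ a (suc k) = trans (cong (toℚ a *_) (toℚ-^ a k)) (sym (toℚ-* a (a ℤ.^ k)))

  toℚ-injective-0 : ∀ z → toℚ z ≡ 0ℚ → z ≡ + 0
  toℚ-injective-0 z eq = trans (sym (ℤP.*-identityʳ z))
    (ℚᵘP.drop-*≡* (ℚᵘP.≃-trans (ℚᵘP.≃-sym (toℚᵘ-toℚ z)) (ℚᵘP.≃-reflexive (cong toℚᵘ eq))))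

  inv-inverse : ∀ x → x ≢ 0ℚ → inv x * x ≡ 1ℚ
  inv-inverse x x≢0 with x ℚP.≟ 0ℚ
  ... | yes x≡0 = ⊥-elim (x≢0 x≡0)
  ... | no  x≢0′ = ℚP.*-inverseˡ x {{ℚ.≢-nonZero x≢0′}}

  clear-denominators : ∀ M → M ≢ + 0 → ∀ N (c : ℕ → ℤ) →
    Σ₁ N (λ k → toℚ (c k) * inv (toℚ M ^ℚ k)) * toℚ M ^ℚ N ≡ toℚ (horner M N c)
  clear-denominators M M≢0 zero    c = ℚP.*-zeroˡ 1ℚ
  clear-denominators M M≢0 (suc N) c = begin
      (S + a * I) * (toℚ M * Y)
        ≡⟨ expand S a I (toℚ M) Y ⟩
      toℚ M * (S * Y) + a * (I * (toℚ M * Y))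
        ≡⟨ cong₂ (λ u v → toℚ M * u + a * v) (clear-denominators M M≢0 N c) (inv-inverse (toℚ M * Y) Mᴺ⁺¹≢0) ⟩
      toℚ M * toℚ (horner M N c) + a * 1ℚ
        ≡⟨ cong (_+_ (toℚ M * toℚ (horner M N c))) (ℚP.*-identityʳ a) ⟩
      toℚ M * toℚ (horner M N c) + a
        ≡⟨ trans (toℚ-+ (M ℤ.* horner M N c) (c (suc N))) (cong (_+ a) (toℚ-* M _)) ⟨
      toℚ (horner M (suc N) c) ∎
    where
      open ≡-Reasoning
      S = Σ₁ N (λ k → toℚ (c k) * inv (toℚ M ^ℚ k))
      a = toℚ (c (suc N))
      I = inv (toℚ M ^ℚ suc N)
      Y = toℚ M ^ℚ N
      expand : ∀ S a I M Y → (S + a * I) * (M * Y) ≡ M * (S * Y) + a * (I * (M * Y))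
      expand = solve 5 (λ S a I M Y → (S :+ a :* I) :* (M :* Y) := M :* (S :* Y) :+ a :* (I :* (M :* Y))) refl
      Mᴺ⁺¹≢0 : toℚ M ^ℚ suc N ≢ 0ℚ
      Mᴺ⁺¹≢0 eq = M≢0 (ℤP.i^n≡0⇒i≡0 M (suc N) (toℚ-injective-0 _ (trans (sym (toℚ-^ M (suc N))) eq)))

  -- A rational x with x · u = t for integers u, t with p ∤ u and p ∣ t lies in pℤ_p:
  -- writing x = num/den in lowest terms, num · u = t · den, so p ∣ num and p ∤ den.
  ∈pℤₚ : ∀ {p} → Prime p → ∀ x u t → x * toℚ u ≡ toℚ t → ¬ + p ℤ∣.∣ u → + p ℤ∣.∣ t → InPZp p x
  ∈pℤₚ {p} p-prime x@(mkℚ num den coprime) u t xu≡t p∤u p∣t = ℤ∣.∣⇒∣ᵤ p∣num , p∤den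
    where
      open Congruence p using (euclid; ∣-resp)
      xu≃t : mkℚᵘ num den ℚᵘ.* mkℚᵘ u 0 ℚᵘ.≃ mkℚᵘ t 0
      xu≃t = ℚᵘP.≃-trans
        (ℚᵘP.≃-sym (ℚᵘP.≃-trans (ℚP.toℚᵘ-homo-* x (toℚ u)) (ℚᵘP.*-cong (ℚᵘP.≃-refl {toℚᵘ x}) (toℚᵘ-toℚ u))))
        (ℚᵘP.≃-trans (ℚᵘP.≃-reflexive (cong toℚᵘ xu≡t)) (toℚᵘ-toℚ t))
      p∣num*u : + p ℤ∣.∣ num ℤ.* u
      p∣num*u = ∣-resp (trans (sym (ℚᵘP.drop-*≡* xu≃t)) (ℤP.*-identityʳ (num ℤ.* u))) (ℤ∣.∣m⇒∣m*n _ p∣t)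
      p∣num : + p ℤ∣.∣ num
      p∣num = [ (λ p∣num → p∣num) , (λ p∣u → ⊥-elim (p∤u p∣u)) ]′ (euclid p-prime num u p∣num*u)
      p∤den : ¬ (p ℕ∣.∣ suc den)
      p∤den p∣den = ℕ.nonTrivial⇒≢1 {{prime⇒nonTrivial p-prime}}
                      (Coprimality.recompute coprime (ℤ∣.∣⇒∣ᵤ p∣num , p∣den))

  module RationalForm (q : ℕ) (p-prime : Prime (suc (suc q))) (m : ℕ)
                      (p∤m : ¬ (suc (suc q) ℕ∣.∣ m)) where
    open Fermat q p-prime using (p)
    open IntegerCongruence q p-prime m p∤m
    open Congruence p using (p∣0; ∤-^)

    -ιm≡M : - ι m ≡ toℚ M
    -ιm≡M = sym (toℚ-neg (+ m))

    M≢0 : M ≢ + 0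
    M≢0 M≡0 = p∤M (subst (+ p ℤ∣.∣_) (sym M≡0) p∣0)

    constant-term : ∀ j s → (if j ≡ᵇ 0 then ι (s !) else 0ℚ) ≡ toℚ (+ ((j ℕ.+ s) !) ℤ.* δ₀ j)
    constant-term zero    s = cong toℚ (sym (ℤP.*-identityʳ (+ (s !))))
    constant-term (suc j) s = cong toℚ (sym (ℤP.*-zeroʳ (+ ((suc j ℕ.+ s) !))))

    lhs-cleared : ∀ r s n j → lhsCoeff p n m r s j * toℚ (M ℤ.^ suc q) ≡ toℚ (lhs-integer r s n j)
    lhs-cleared r s n j = begin
        lhsCoeff p n m r s j * toℚ (M ℤ.^ suc q)
          ≡⟨ cong₂ _*_ (cong (λ x → Σ₁ (suc q) (λ k → ι (c k) * inv (x ^ℚ k))) -ιm≡M) (sym (toℚ-^ M (suc q))) ⟩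
        Σ₁ (suc q) (λ k → toℚ (+ c k) * inv (toℚ M ^ℚ k)) * toℚ M ^ℚ suc q
          ≡⟨ clear-denominators M M≢0 (suc q) (λ k → + c k) ⟩
        toℚ (lhs-integer r s n j) ∎
      where
        open ≡-Reasoning
        c : ℕ → ℕ
        c k = fubiniCoeff r s (n ℕ.+ k) j

    rhs-cleared : ∀ r s n j → rhsCoeff p n m r s j * toℚ (M ℤ.^ suc q) ≡ toℚ (rhs-integer r s n j)
    rhs-cleared r s n j = begin
        ((- ι m) ^ℚ n * (ι F′ - (if j ≡ᵇ 0 then ι (s !) else 0ℚ))) * toℚ Mᵖ⁻¹
          ≡⟨ cong₂ (λ x e → (x * (ι F′ - e)) * toℚ Mᵖ⁻¹)
                   (trans (cong (_^ℚ n) -ιm≡M) (toℚ-^ M n)) (constant-term j s) ⟩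
        (toℚ Mⁿ * (toℚ (+ F′) - toℚ E)) * toℚ Mᵖ⁻¹
          ≡⟨ cong (λ x → (toℚ Mⁿ * x) * toℚ Mᵖ⁻¹) (sym (toℚ-− (+ F′) E)) ⟩
        (toℚ Mⁿ * toℚ (+ F′ ℤ.- E)) * toℚ Mᵖ⁻¹
          ≡⟨ cong (_* toℚ Mᵖ⁻¹) (sym (toℚ-* Mⁿ (+ F′ ℤ.- E))) ⟩
        toℚ (Mⁿ ℤ.* (+ F′ ℤ.- E)) * toℚ Mᵖ⁻¹
          ≡⟨ ℚP.*-comm (toℚ (Mⁿ ℤ.* (+ F′ ℤ.- E))) (toℚ Mᵖ⁻¹) ⟩
        toℚ Mᵖ⁻¹ * toℚ (Mⁿ ℤ.* (+ F′ ℤ.- E))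
          ≡⟨ toℚ-* Mᵖ⁻¹ (Mⁿ ℤ.* (+ F′ ℤ.- E)) ⟨
        toℚ (rhs-integer r s n j) ∎
      where
        open ≡-Reasoning
        Mᵖ⁻¹ = M ℤ.^ suc q
        Mⁿ = M ℤ.^ n
        F′ = fubiniCoeff (r ℕ.+ m) s (suc q) j
        E = + ((j ℕ.+ s) !) ℤ.* δ₀ j

    -- The theorem for p = q + 2: the difference of the x^j-coefficients, times the
    -- p-adic unit M^(p-1), is an integer divisible by p.
    coefficient-congruence : ∀ r s n j → InPZp p (lhsCoeff p n m r s j - rhsCoeff p n m r s j)
    coefficient-congruence r s n j =
      ∈pℤₚ p-prime (L - R) Mᵖ⁻¹ (lhs-integer r s n j ℤ.- rhs-integer r s n j)
           cleared (∤-^ p-prime p∤M (suc q)) (fubini-congruence r s n j)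
      where
        L = lhsCoeff p n m r s j
        R = rhsCoeff p n m r s j
        Mᵖ⁻¹ = M ℤ.^ suc q
        cleared : (L - R) * toℚ Mᵖ⁻¹ ≡ toℚ (lhs-integer r s n j ℤ.- rhs-integer r s n j)
        cleared = begin
            (L - R) * toℚ Mᵖ⁻¹
              ≡⟨ ℚP.*-distribʳ-+ (toℚ Mᵖ⁻¹) L (- R) ⟩
            L * toℚ Mᵖ⁻¹ + - R * toℚ Mᵖ⁻¹
              ≡⟨ cong (_+_ (L * toℚ Mᵖ⁻¹)) (sym (ℚP.neg-distribˡ-* R (toℚ Mᵖ⁻¹))) ⟩
            L * toℚ Mᵖ⁻¹ + - (R * toℚ Mᵖ⁻¹)
              ≡⟨ cong₂ (λ a b → a + - b) (lhs-cleared r s n j) (rhs-cleared r s n j) ⟩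
            toℚ (lhs-integer r s n j) - toℚ (rhs-integer r s n j)
              ≡⟨ toℚ-− (lhs-integer r s n j) (rhs-integer r s n j) ⟨
            toℚ (lhs-integer r s n j ℤ.- rhs-integer r s n j) ∎
          where open ≡-Reasoning

theorem13 : (n m r s p : ℕ) → Prime p → ¬ (p ℕ∣.∣ m) →
    (j : ℕ) → InPZp p (lhsCoeff p n m r s j ℚ.- rhsCoeff p n m r s j)
-- p = 0 and p = 1 are not prime; for p = q + 2 the theorem is coefficient-congruence.
theorem13 n m r s zero          p-prime p∤m j = ⊥-elim (ℕ.NonTrivial.nonTrivial (prime⇒nonTrivial p-prime))
theorem13 n m r s (suc zero)    p-prime p∤m j = ⊥-elim (ℕ.NonTrivial.nonTrivial (prime⇒nonTrivial p-prime))
theorem13 n m r s (suc (suc q)) p-prime p∤m j = OverRationals.RationalForm.coefficient-congruence q p-prime m p∤m r s n j
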